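{- Let $M$ be a partial commutative monoid that is moreover an effect algebra, with induced difference $n-m$ (the unique $k$ with $m+k=n$, defined when $m\preceq n$), and let $(\{\mathbb{E}_m\},\nabla,\eta)$ be an $M$-graded effect monoid. Then $\{D_{\mathbb{E}_m}\}$, with unit $\eta(x)=1_{\mathbb{E}_0}\bullet x$ and multiplication $\mu_{m,n}(\sum_i e_i\bullet\Delta_i)(x)=\sum_i\nabla_{m,n}(e_i,\Delta_i(x))$, is an extensible $M$-graded monad with extension $\xi_{m\preceq n}:D_{\mathbb{E}_m}\to D_{\mathbb{E}_n}$ given by $\xi_{m\preceq n}(\sum_i e_i\bullet x_i)=\sum_i\nabla_{m,n-m}(e_i,1_{\mathbb{E}_{n-m}})\bullet x_i$.
   Context: A partial commutative monoid (PCM) $\langle M,0,+\rangle$ has a partial, commutative, associative operation $+$ with unit $0$ ($a\perp b$ means $a+b$ is defined); its preorder is $a\preceq b$ iff $a+c=b$ for some $c$. An effect algebra is a PCM with $e\mapsto e'$ such that $e'$ is the unique element with $e+e'=1:=0'$ and $e\perp1\Rightarrow e=0$. Effect morphisms preserve $0$, defined sums and $'$; morphisms $\mathbb{E}_A\otimes\mathbb{E}_B\to\mathbb{E}_C$ in the monoidal category $\mathbf{EA}$ (unit $2=\{0,1\}$) correspond to bimorphisms $\mathbb{E}_A\times\mathbb{E}_B\to\mathbb{E}_C$ (PCM homomorphisms in each argument sending $(1,1)$ to $1$). An $M$-graded effect monoid: effect algebras $\mathbb{E}_m$, bimorphisms $\nabla_{m,n}:\mathbb{E}_m\times\mathbb{E}_n\to\mathbb{E}_{m+n}$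 for $m\perp n$, an effect morphism $\eta:2\to\mathbb{E}_0$, with $\nabla_{m+n,o}(\nabla_{m,n}(a,b),c)=\nabla_{m,n+o}(a,\nabla_{n,o}(b,c))$ and $\nabla_{0,m}(\eta(1),a)=a=\nabla_{m,0}(a,\eta(1))$. $D_{\mathbb{E}}X$: finitely supported $\Delta:X\to\mathbb{E}$ whose sum over the support is defined; $(D_{\mathbb{E}}f)(\Delta)(y)=\sum_{x\in f^{ -1}(y)}\Delta(x)$; $\sum_ie_i\bullet x_i$ assigns $e_i$ to $x_i$. An $M$-graded monad on $\mathbf{Set}$: endofunctors $T_m$, natural $\eta:\mathrm{Id}\to T_0$, natural $\mu_{m,n}:T_mT_n\to T_{m+n}$ for $m\perp n$, with $\mu_{m,n+o}\circ T_m\mu_{n,o}=\mu_{m+n,o}\circ\mu_{m,n}T_o$ and $\mu_{m,0}\circ T_m\eta=\mathrm{id}=\mu_{0,m}\circ\eta T_m$. It is extensible if for all $m\preceq n$ there is a natural transformation $\xi_{m\preceq n}:T_m\to T_n$ with $\xi_{m\preceq m}=\mathrm{Id}$ and $\xi_{n\preceq o}\circ\xi_{m\preceq n}=\xi_{m\preceq o}$. -}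

module Defs where

open import Level using (0ℓ)
open import Data.Bool using (Bool; true; false; not)
open import Data.Maybe using (Maybe; just; nothing; _>>=_)
open import Data.Product using (Σ; ∃; _,_; proj₁; proj₂; _×_)
open import Data.List using (List; []; _∷_; map)
open import Data.List.Membership.Propositional using (_∉_)
open import Data.List.Relation.Unary.Unique.Propositional using (Unique)
open import Relation.Binary.PropositionalEquality using (_≡_; refl)
open import Relation.Binary.Structures using (IsEquivalence)
open import Relation.Nullary using (¬_)
open import Function using (id; _∘_)

record PCM : Set₁ where
  field
    Carrier : Set
    𝟘       : Carrier
    _⊕_     : Carrier → Carrier → Maybe Carrier
    ⊕-comm  : ∀ a b → a ⊕ b ≡ b ⊕ a
    -- (a+b)+c defined iff a+(b+c) defined, and then they are equal
    ⊕-assoc : ∀ a b c → ((a ⊕ b) >>= λ ab → ab ⊕ c) ≡ ((b ⊕ c) >>= λ bc → a ⊕ bc)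
    ⊕-identityˡ : ∀ a → 𝟘 ⊕ a ≡ just a

  _⊥_ : Carrier → Carrier → Set
  a ⊥ b = ∃ λ c → a ⊕ b ≡ just c

  _≼_ : Carrier → Carrier → Set
  a ≼ b = ∃ λ c → a ⊕ c ≡ just b

module _ (P : PCM) where
  open PCM P
  sumL : List Carrier → Maybe Carrier
  sumL []       = just 𝟘
  sumL (e ∷ es) = sumL es >>= λ s → e ⊕ s

record EffectAlgebra : Set₁ where
  field
    pcm : PCM
  open PCM pcm public
  field
    _′ : Carrier → Carrier
  𝟙 : Carrier
  𝟙 = 𝟘 ′
  field
    ′-sum    : ∀ e → e ⊕ (e ′) ≡ just 𝟙
    ′-unique : ∀ e d → e ⊕ d ≡ just 𝟙 → d ≡ e ′
    zero-one : ∀ e → e ⊥ 𝟙 → e ≡ 𝟘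

private
  _⊕₂_ : Bool → Bool → Maybe Bool
  false ⊕₂ b     = just b
  true  ⊕₂ false = just true
  true  ⊕₂ true  = nothing

  comm₂ : ∀ a b → a ⊕₂ b ≡ b ⊕₂ a
  comm₂ false false = refl
  comm₂ false true  = refl
  comm₂ true  false = refl
  comm₂ true  true  = refl

  assoc₂ : ∀ a b c → ((a ⊕₂ b) >>= λ ab → ab ⊕₂ c) ≡ ((b ⊕₂ c) >>= λ bc → a ⊕₂ bc)
  assoc₂ false false false = refl
  assoc₂ false false true  = refl
  assoc₂ false true  false = refl
  assoc₂ false true  true  = refl
  assoc₂ true  false false = refl
  assoc₂ true  false true  = refl
  assoc₂ true  true  false = refl
  assoc₂ true  true  true  = refl

  pcm₂ : PCM
  pcm₂ = record { Carrier = Bool ; 𝟘 = false ; _⊕_ = _⊕₂_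
                ; ⊕-comm = comm₂ ; ⊕-assoc = assoc₂ ; ⊕-identityˡ = λ _ → refl }

  sum₂ : ∀ e → e ⊕₂ not e ≡ just true
  sum₂ false = refl
  sum₂ true  = refl

  unique₂ : ∀ e d → e ⊕₂ d ≡ just true → d ≡ not e
  unique₂ false true  refl = refl
  unique₂ true  false refl = refl

  zero-one₂ : ∀ e → PCM._⊥_ pcm₂ e true → e ≡ false
  zero-one₂ false _ = refl
  zero-one₂ true (_ , ())

𝟚 : EffectAlgebra
𝟚 = record { pcm = pcm₂ ; _′ = not ; ′-sum = sum₂ ; ′-unique = unique₂ ; zero-one = zero-one₂ }

module _ (A B : EffectAlgebra) where
  private
    module A = EffectAlgebra A
    module B = EffectAlgebra B

  record IsEffectMorphism (f : A.Carrier → B.Carrier) : Set where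
    field
      pres-𝟘 : f A.𝟘 ≡ B.𝟘
      pres-⊕ : ∀ a a' s → a A.⊕ a' ≡ just s → f a B.⊕ f a' ≡ just (f s)
      pres-′ : ∀ a → f (a A.′) ≡ (f a) B.′

module _ (A B C : EffectAlgebra) where
  private
    module A = EffectAlgebra A
    module B = EffectAlgebra B
    module C = EffectAlgebra C

  record IsBimorphism (f : A.Carrier → B.Carrier → C.Carrier) : Set where
    field
      zeroˡ : ∀ b → f A.𝟘 b ≡ C.𝟘
      addˡ  : ∀ a a' s b → a A.⊕ a' ≡ just s → f a b C.⊕ f a' b ≡ just (f s b)
      zeroʳ : ∀ a → f a B.𝟘 ≡ C.𝟘
      addʳ  : ∀ a b b' s → b B.⊕ b' ≡ just s → f a b C.⊕ f a b' ≡ just (f a s)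
      one   : f A.𝟙 B.𝟙 ≡ C.𝟙

record GradedEffectMonoid (M : EffectAlgebra) : Set₁ where
  private module M = EffectAlgebra M
  field
    𝔼 : M.Carrier → EffectAlgebra
    ∇ : ∀ {m n mn} → m M.⊕ n ≡ just mn →
        EffectAlgebra.Carrier (𝔼 m) → EffectAlgebra.Carrier (𝔼 n) → EffectAlgebra.Carrier (𝔼 mn)
    ∇-bimorphism : ∀ {m n mn} (p : m M.⊕ n ≡ just mn) → IsBimorphism (𝔼 m) (𝔼 n) (𝔼 mn) (∇ p)
    η : Bool → EffectAlgebra.Carrier (𝔼 M.𝟘)
    η-morphism : IsEffectMorphism 𝟚 (𝔼 M.𝟘) η
    ∇-assoc : ∀ {m n o mn no mno}
              (p : m M.⊕ n ≡ just mn) (q : mn M.⊕ o ≡ just mno)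
              (r : n M.⊕ o ≡ just no) (s : m M.⊕ no ≡ just mno) a b c →
              ∇ q (∇ p a b) c ≡ ∇ s a (∇ r b c)
    ∇-unitˡ : ∀ {m} (p : M.𝟘 M.⊕ m ≡ just m) a → ∇ p (η true) a ≡ a
    ∇-unitʳ : ∀ {m} (p : m M.⊕ M.𝟘 ≡ just m) a → ∇ p a (η true) ≡ a

-- Graded monads on Set (equalities of elements of T m X are taken up to a
-- given equivalence _≈_, since T m X will be a type of functions)

module _ (M : PCM) where
  open PCM M

  record IsGradedMonad
    (T     : Carrier → Set → Set)
    (_≈_   : ∀ {m X} → T m X → T m X → Set)
    (fmap  : ∀ {m X Y} → (X → Y) → T m X → T m Y)
    (η     : ∀ {X} → X → T 𝟘 X)
    (μ     : ∀ {m n mn X} → m ⊕ n ≡ just mn → T m (T n X) → T mn X)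
    : Set₁ where
    field
      ≈-equiv   : ∀ {m X} → IsEquivalence (_≈_ {m} {X})
      fmap-cong : ∀ {m X Y} (f : X → Y) {t t' : T m X} → t ≈ t' → fmap f t ≈ fmap f t'
      fmap-ext  : ∀ {m X Y} (f g : X → Y) → (∀ x → f x ≡ g x) → (t : T m X) → fmap f t ≈ fmap g t
      fmap-id   : ∀ {m X} (t : T m X) → fmap id t ≈ t
      fmap-∘    : ∀ {m X Y Z} (f : Y → Z) (g : X → Y) (t : T m X) →
                  fmap (f ∘ g) t ≈ fmap f (fmap g t)
      η-natural : ∀ {X Y} (f : X → Y) (x : X) → fmap f (η x) ≈ η (f x)
      μ-cong    : ∀ {m n mn X} (p : m ⊕ n ≡ just mn) {t t' : T m (T n X)} →
                  t ≈ t' → μ p t ≈ μ p t'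
      μ-natural : ∀ {m n mn X Y} (p : m ⊕ n ≡ just mn) (f : X → Y) (t : T m (T n X)) →
                  fmap f (μ p t) ≈ μ p (fmap (fmap f) t)
      μ-assoc   : ∀ {m n o mn no mno X}
                  (p : m ⊕ n ≡ just mn) (q : mn ⊕ o ≡ just mno)
                  (r : n ⊕ o ≡ just no) (s : m ⊕ no ≡ just mno)
                  (t : T m (T n (T o X))) →
                  μ s (fmap (μ r) t) ≈ μ q (μ p t)
      μ-unitʳ   : ∀ {m X} (p : m ⊕ 𝟘 ≡ just m) (t : T m X) → μ p (fmap η t) ≈ t
      μ-unitˡ   : ∀ {m X} (p : 𝟘 ⊕ m ≡ just m) (t : T m X) → μ p (η t) ≈ t

  record IsExtensibleGradedMonad
    (T     : Carrier → Set → Set)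
    (_≈_   : ∀ {m X} → T m X → T m X → Set)
    (fmap  : ∀ {m X Y} → (X → Y) → T m X → T m Y)
    (η     : ∀ {X} → X → T 𝟘 X)
    (μ     : ∀ {m n mn X} → m ⊕ n ≡ just mn → T m (T n X) → T mn X)
    (ξ     : ∀ {m n X} → m ≼ n → T m X → T n X)
    : Set₁ where
    field
      isGradedMonad : IsGradedMonad T _≈_ fmap η μ
      ξ-cong    : ∀ {m n X} (p : m ≼ n) {t t' : T m X} → t ≈ t' → ξ p t ≈ ξ p t'
      ξ-natural : ∀ {m n X Y} (p : m ≼ n) (f : X → Y) (t : T m X) →
                  fmap f (ξ p t) ≈ ξ p (fmap f t)
      ξ-refl    : ∀ {m X} (p : m ≼ m) (t : T m X) → ξ p t ≈ t
      ξ-trans   : ∀ {m n o X} (p : m ≼ n) (q : n ≼ o) (r : m ≼ o) (t : T m X) →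
                  ξ q (ξ p t) ≈ ξ r t

module _ (E : EffectAlgebra) where
  open EffectAlgebra E

  record D (X : Set) : Set where
    field
      Δ           : X → Carrier
      supp        : List X
      supp-unique : Unique supp
      supp-covers : ∀ x → x ∉ supp → Δ x ≡ 𝟘
      sum-defined : ∃ λ s → sumL pcm (map Δ supp) ≡ just s

  _≈D_ : ∀ {X} → D X → D X → Set
  d ≈D d' = ∀ x → D.Δ d x ≡ D.Δ d' x

  data PreSum {X Y : Set} (Δ : X → Carrier) (f : X → Y) (y : Y) : List X → Carrier → Set where
    []   : PreSum Δ f y [] 𝟘
    hit  : ∀ {x xs s s'} → f x ≡ y → PreSum Δ f y xs s → Δ x ⊕ s ≡ just s' →
           PreSum Δ f y (x ∷ xs) s'
    miss : ∀ {x xs s} → ¬ (f x ≡ y) → PreSum Δ f y xs s → PreSum Δ f y (x ∷ xs) s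

module _ (M : EffectAlgebra) (G : GradedEffectMonoid M) where
  private module M = EffectAlgebra M
  open GradedEffectMonoid G
  private
    C : M.Carrier → Set
    C m = EffectAlgebra.Carrier (𝔼 m)
    𝟘ᵉ : ∀ m → C m
    𝟘ᵉ m = EffectAlgebra.𝟘 (𝔼 m)
    𝟙ᵉ : ∀ m → C m
    𝟙ᵉ m = EffectAlgebra.𝟙 (𝔼 m)

  record DOperations : Set₁ where
    field
      fmap : ∀ {m X Y} → (X → Y) → D (𝔼 m) X → D (𝔼 m) Y
      unit : ∀ {X} → X → D (𝔼 M.𝟘) X
      mult : ∀ {m n mn X} → m M.⊕ n ≡ just mn → D (𝔼 m) (D (𝔼 n) X) → D (𝔼 mn) X
      ext  : ∀ {m n X} → m M.≼ n → D (𝔼 m) X → D (𝔼 n) X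
      fmap-spec : ∀ {m X Y} (f : X → Y) (d : D (𝔼 m) X) (y : Y) →
                  PreSum (𝔼 m) (D.Δ d) f y (D.supp d) (D.Δ (fmap f d) y)
      unit-spec-at  : ∀ {X} (x : X) → D.Δ (unit x) x ≡ 𝟙ᵉ M.𝟘
      unit-spec-off : ∀ {X} (x y : X) → ¬ (x ≡ y) → D.Δ (unit x) y ≡ 𝟘ᵉ M.𝟘
      mult-spec : ∀ {m n mn X} (p : m M.⊕ n ≡ just mn) (Φ : D (𝔼 m) (D (𝔼 n) X)) (x : X) →
                  sumL (EffectAlgebra.pcm (𝔼 mn))
                       (map (λ Ψ → ∇ p (D.Δ Φ Ψ) (D.Δ Ψ x)) (D.supp Φ))
                  ≡ just (D.Δ (mult p Φ) x)
      -- ξ_{m≼n}(Σ_i e_i • x_i) = Σ_i ∇_{m,n-m}(e_i, 1) • x_i, where the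
      -- witness p = (n - m , m + (n - m) = n)
      ext-spec : ∀ {m n X} (p : m M.≼ n) (d : D (𝔼 m) X) (x : X) →
                 D.Δ (ext p d) x ≡ ∇ (proj₂ p) (D.Δ d x) (𝟙ᵉ (proj₁ p))

  IsExtensibleGradedMonadD : DOperations → Set₁
  IsExtensibleGradedMonadD ops =
    IsExtensibleGradedMonad M.pcm (λ m → D (𝔼 m)) (λ {m} → _≈D_ (𝔼 m))
      fmap unit mult ext
    where open DOperations ops

-- Partial sums are lifted to Maybe, where nothing (undefined) is absorbing, so they form a total
-- commutative monoid in which finite double sums can be interchanged. With excluded middle equality
-- is decidable, so each value Δ y is a sum over the support against the Kronecker delta [x ≡ y].
-- Since ∇ is additive in each argument, every monad law becomes the interchange of a double sum
-- followed by the collapse of a delta. μ Φ is summable because its total weight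
-- Σ_Ψ ∇(Φ Ψ, Σ_x Ψ x) is a part of Σ_Ψ ∇(Φ Ψ, 1) = ∇(Σ_Ψ Φ Ψ, 1). The extension laws follow from
-- the associativity of ∇ together with ∇(1, 1) = 1, and from the uniqueness of the difference
-- n − m, which is cancellation in the effect algebra M.

module Submission where

open import Defs
open import Level using (0ℓ)
open import Algebra.Bundles using (CommutativeMonoid)
open import Algebra.Structures.Biased using (isCommutativeMonoidˡ)
import Algebra.Properties.CommutativeSemigroup as CommutativeSemigroupProperties
open import Axiom.ExcludedMiddle using (ExcludedMiddle)
open import Axiom.UniquenessOfIdentityProofs using (module Decidable⇒UIP)
open import Data.Bool using (true; false)
open import Data.Empty using (⊥-elim)
open import Data.List using (List; []; _∷_; map; concatMap; deduplicate)
open import Data.List.Membership.Propositional using (_∈_; _∉_; lose)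
open import Data.List.Membership.Propositional.Properties using (∈-map⁺; ∈-concatMap⁺; ∈-deduplicate⁺)
import Data.List.Relation.Unary.All as All
open import Data.List.Relation.Unary.Any using (here; there)
open import Data.List.Relation.Unary.Unique.Propositional using (Unique; []; _∷_)
open import Data.List.Relation.Unary.Unique.Propositional.Properties using (Unique[x∷xs]⇒x∉xs)
open import Data.List.Relation.Unary.Unique.DecPropositional.Properties using (deduplicate-!)
open import Data.Maybe using (Maybe; just; nothing; _>>=_)
import Data.Maybe as Maybe
open import Data.Maybe.Properties using (just-injective)
open import Data.Product using (Σ; ∃; _,_; proj₁; proj₂; _×_)
open import Function using (id; _∘_)
open import Relation.Binary.Definitions using (DecidableEquality)
open import Relation.Binary.PropositionalEquality
  using (_≡_; refl; sym; trans; cong; cong₂; subst; isEquivalence; module ≡-Reasoning)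
open import Relation.Nullary using (¬_; Dec; yes; no)

>>=-just⁻ : ∀ {A B : Set} (ma : Maybe A) {f : A → Maybe B} {b} →
            (ma >>= f) ≡ just b → ∃ λ a → ma ≡ just a × f a ≡ just b
>>=-just⁻ (just a) fa≡b = a , refl , fa≡b

module PCMSums (P : PCM) where
  open PCM P

  ⊕-identityʳ : ∀ a → a ⊕ 𝟘 ≡ just a
  ⊕-identityʳ a = trans (⊕-comm a 𝟘) (⊕-identityˡ a)

  infixl 6 _⊕?_
  _⊕?_ : Maybe Carrier → Maybe Carrier → Maybe Carrier
  a ⊕? b = a >>= λ a′ → b >>= λ b′ → a′ ⊕ b′

  Defined : Maybe Carrier → Set
  Defined a = ∃ λ s → a ≡ just s

  ⊕?-comm : ∀ a b → a ⊕? b ≡ b ⊕? a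
  ⊕?-comm (just a) (just b) = ⊕-comm a b
  ⊕?-comm (just _) nothing  = refl
  ⊕?-comm nothing  (just _) = refl
  ⊕?-comm nothing  nothing  = refl

  ⊕?-assoc : ∀ a b c → (a ⊕? b) ⊕? c ≡ a ⊕? (b ⊕? c)
  ⊕?-assoc (just a) (just b) (just c) = ⊕-assoc a b c
  ⊕?-assoc (just a) (just b) nothing with a ⊕ b
  ... | just _  = refl
  ... | nothing = refl
  ⊕?-assoc (just _) nothing  _        = refl
  ⊕?-assoc nothing  _        _        = refl

  ⊕?-identityˡ : ∀ a → just 𝟘 ⊕? a ≡ a
  ⊕?-identityˡ (just a) = ⊕-identityˡ a
  ⊕?-identityˡ nothing  = refl

  ⊕?-commutativeMonoid : CommutativeMonoid 0ℓ 0ℓ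
  ⊕?-commutativeMonoid = record
    { Carrier = Maybe Carrier ; _≈_ = _≡_ ; _∙_ = _⊕?_ ; ε = just 𝟘
    ; isCommutativeMonoid = isCommutativeMonoidˡ record
      { isSemigroup = record
        { isMagma = record { isEquivalence = isEquivalence ; ∙-cong = cong₂ _⊕?_ }
        ; assoc   = ⊕?-assoc }
      ; identityˡ = ⊕?-identityˡ
      ; comm      = ⊕?-comm } }

  open CommutativeMonoid ⊕?-commutativeMonoid public
    using () renaming (identityʳ to ⊕?-identityʳ)
  open CommutativeSemigroupProperties (CommutativeMonoid.commutativeSemigroup ⊕?-commutativeMonoid)
    using () renaming (interchange to ⊕?-interchange)

  ⊕?-definedˡ : ∀ a b → Defined (a ⊕? b) → Defined a
  ⊕?-definedˡ (just a) _ _       = a , refl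
  ⊕?-definedˡ nothing  _ (_ , ())

  ⊕?-just⁻ : ∀ a b {s} → a ⊕? b ≡ just s →
             ∃ λ a′ → ∃ λ b′ → a ≡ just a′ × b ≡ just b′ × a′ ⊕ b′ ≡ just s
  ⊕?-just⁻ (just a) (just b) a⊕b = a , b , refl , refl , a⊕b

  sumBy : {A : Set} → (A → Maybe Carrier) → List A → Maybe Carrier
  sumBy g []       = just 𝟘
  sumBy g (x ∷ xs) = g x ⊕? sumBy g xs

  SupportedOn : {A : Set} → (A → Maybe Carrier) → List A → Set
  SupportedOn g xs = ∀ x → x ∉ xs → g x ≡ just 𝟘

  sumL-map : {A : Set} (h : A → Carrier) (xs : List A) → sumL P (map h xs) ≡ sumBy (just ∘ h) xs
  sumL-map h []       = refl
  sumL-map h (x ∷ xs) = cong (_>>= h x ⊕_) (sumL-map h xs)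

  sumBy-cong : {A : Set} {g h : A → Maybe Carrier} (xs : List A) →
               (∀ x → x ∈ xs → g x ≡ h x) → sumBy g xs ≡ sumBy h xs
  sumBy-cong []       g≡h = refl
  sumBy-cong (x ∷ xs) g≡h = cong₂ _⊕?_ (g≡h x (here refl)) (sumBy-cong xs (λ y → g≡h y ∘ there))

  sumBy-zero : {A : Set} {g : A → Maybe Carrier} (xs : List A) →
               (∀ x → x ∈ xs → g x ≡ just 𝟘) → sumBy g xs ≡ just 𝟘
  sumBy-zero []       g≡𝟘 = refl
  sumBy-zero (x ∷ xs) g≡𝟘 =
    trans (cong₂ _⊕?_ (g≡𝟘 x (here refl)) (sumBy-zero xs (λ y → g≡𝟘 y ∘ there)))
          (⊕?-identityˡ (just 𝟘))

  sumBy-⊕? : {A : Set} (g h : A → Maybe Carrier) (xs : List A) →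
             sumBy (λ x → g x ⊕? h x) xs ≡ sumBy g xs ⊕? sumBy h xs
  sumBy-⊕? g h []       = sym (⊕?-identityˡ (just 𝟘))
  sumBy-⊕? g h (x ∷ xs) =
    trans (cong (g x ⊕? h x ⊕?_) (sumBy-⊕? g h xs)) (⊕?-interchange (g x) (h x) (sumBy g xs) (sumBy h xs))

  sumBy-swap : {A B : Set} (f : A → B → Maybe Carrier) (xs : List A) (ys : List B) →
               sumBy (λ x → sumBy (f x) ys) xs ≡ sumBy (λ y → sumBy (λ x → f x y) xs) ys
  sumBy-swap f []       ys = sym (sumBy-zero ys (λ _ _ → refl))
  sumBy-swap f (x ∷ xs) ys =
    trans (cong (sumBy (f x) ys ⊕?_) (sumBy-swap f xs ys)) (sym (sumBy-⊕? (f x) _ ys))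

  summand-defined : {A : Set} (g : A → Maybe Carrier) {xs : List A} {x : A} →
                    x ∈ xs → Defined (sumBy g xs) → Defined (g x)
  summand-defined g {y ∷ xs} (here refl) def = ⊕?-definedˡ (g y) (sumBy g xs) def
  summand-defined g {y ∷ xs} (there x∈) def =
    summand-defined g x∈ (⊕?-definedˡ (sumBy g xs) (g y) (subst Defined (⊕?-comm (g y) (sumBy g xs)) def))

  when : {Q : Set} → Dec Q → Maybe Carrier → Maybe Carrier
  when (yes _) a = a
  when (no _)  _ = just 𝟘

  when-yes : {Q : Set} (d : Dec Q) → Q → ∀ a → when d a ≡ a
  when-yes (yes _) _ _ = refl
  when-yes (no ¬q) q _ = ⊥-elim (¬q q)

  when-no : {Q : Set} (d : Dec Q) → ¬ Q → ∀ a → when d a ≡ just 𝟘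
  when-no (yes q) ¬q _ = ⊥-elim (¬q q)
  when-no (no _)  _  _ = refl

  when-zero : {Q : Set} (d : Dec Q) → when d (just 𝟘) ≡ just 𝟘
  when-zero (yes _) = refl
  when-zero (no _)  = refl

  when-⇔ : {Q R : Set} (d : Dec Q) (d′ : Dec R) → (Q → R) → (R → Q) → ∀ a → when d a ≡ when d′ a
  when-⇔ (yes _) (yes _) _   _   _ = refl
  when-⇔ (yes q) (no ¬r) q→r _   _ = ⊥-elim (¬r (q→r q))
  when-⇔ (no ¬q) (yes r) _   r→q _ = ⊥-elim (¬q (r→q r))
  when-⇔ (no _)  (no _)  _   _   _ = refl

  when-comm : {Q R : Set} (d : Dec Q) (d′ : Dec R) (a : Maybe Carrier) →
              when d (when d′ a) ≡ when d′ (when d a)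
  when-comm (yes _) (yes _) _ = refl
  when-comm (yes _) (no _)  _ = refl
  when-comm (no _)  (yes _) _ = refl
  when-comm (no _)  (no _)  _ = refl

  when-sumBy : {Q A : Set} (d : Dec Q) (g : A → Maybe Carrier) (xs : List A) →
               when d (sumBy g xs) ≡ sumBy (λ x → when d (g x)) xs
  when-sumBy (yes _) g xs = refl
  when-sumBy (no _)  g xs = sym (sumBy-zero xs (λ _ _ → refl))

  when-supported : {A : Set} {Q : A → Set} (d : ∀ x → Dec (Q x)) {g : A → Maybe Carrier} {xs : List A} →
                   SupportedOn g xs → SupportedOn (λ x → when (d x) (g x)) xs
  when-supported d g-supp x x∉ = trans (cong (when (d x)) (g-supp x x∉)) (when-zero (d x))

record IsPCMHomomorphism (P Q : PCM) (h : PCM.Carrier P → PCM.Carrier Q) : Set where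
  field
    pres-𝟘 : h (PCM.𝟘 P) ≡ PCM.𝟘 Q
    pres-⊕ : ∀ a b s → PCM._⊕_ P a b ≡ just s → PCM._⊕_ Q (h a) (h b) ≡ just (h s)

module PCMHomomorphism {P Q : PCM} {h : PCM.Carrier P → PCM.Carrier Q} (h-hom : IsPCMHomomorphism P Q h) where
  open IsPCMHomomorphism h-hom
  private
    module ΣP = PCMSums P
    module ΣQ = PCMSums Q

  sumBy-hom : {A : Set} (g : A → Maybe (PCM.Carrier P)) (xs : List A) {s : PCM.Carrier P} →
              ΣP.sumBy g xs ≡ just s → ΣQ.sumBy (Maybe.map h ∘ g) xs ≡ just (h s)
  sumBy-hom g []       refl = cong just (sym pres-𝟘)
  sumBy-hom g (x ∷ xs) gx⊕Σ with ΣP.⊕?-just⁻ (g x) (ΣP.sumBy g xs) gx⊕Σ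
  ... | a , b , gx≡a , Σ≡b , a⊕b rewrite gx≡a | sumBy-hom g xs Σ≡b = pres-⊕ a b _ a⊕b

  when-hom : {R : Set} (d : Dec R) (a : Maybe (PCM.Carrier P)) →
             Maybe.map h (ΣP.when d a) ≡ ΣQ.when d (Maybe.map h a)
  when-hom (yes _) a = refl
  when-hom (no _)  a = cong just pres-𝟘

module Classical (em : ExcludedMiddle 0ℓ) where
  _≟_ : {A : Set} → DecidableEquality A
  _ ≟ _ = em

  _∈?_ : {A : Set} (x : A) (xs : List A) → Dec (x ∈ xs)
  _ ∈? _ = em

module Reindexing (em : ExcludedMiddle 0ℓ) (P : PCM) where
  open PCM P
  open PCMSums P
  open Classical em

  sumBy-δ : {A : Set} (h : A → Maybe Carrier) (z : A) {xs : List A} → Unique xs →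
            sumBy (λ y → when (z ≟ y) (h y)) xs ≡ when (z ∈? xs) (h z)
  sumBy-δ h z [] with z ∈? []
  ... | no _  = refl
  ... | yes ()
  sumBy-δ h z {y ∷ xs} u@(_ ∷ u′) with z ≟ y | z ∈? (y ∷ xs)
  ... | yes refl | no z∉  = ⊥-elim (z∉ (here refl))
  ... | yes refl | yes _  =
    trans (cong (h z ⊕?_) (trans (sumBy-δ h z u′) (when-no (z ∈? xs) (Unique[x∷xs]⇒x∉xs u) (h z))))
          (⊕?-identityʳ (h z))
  ... | no z≢y   | z∈?y∷xs =
    trans (⊕?-identityˡ _) (trans (sumBy-δ h z u′) (when-⇔ (z ∈? xs) z∈?y∷xs there z∈xs (h z)))
    where
      z∈xs : z ∈ y ∷ xs → z ∈ xs
      z∈xs (here z≡y) = ⊥-elim (z≢y z≡y)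
      z∈xs (there z∈) = z∈

  sumBy-δ-∈ : {A : Set} (h : A → Maybe Carrier) (z : A) {xs : List A} → Unique xs → z ∈ xs →
              sumBy (λ y → when (z ≟ y) (h y)) xs ≡ h z
  sumBy-δ-∈ h z {xs} u z∈ = trans (sumBy-δ h z u) (when-yes (z ∈? xs) z∈ (h z))

  sumBy-δ˘ : {A : Set} (h : A → Maybe Carrier) (z : A) {xs : List A} → Unique xs →
             sumBy (λ y → when (y ≟ z) (h y)) xs ≡ when (z ∈? xs) (h z)
  sumBy-δ˘ h z {xs} u = trans (sumBy-cong xs (λ y _ → when-⇔ (y ≟ z) (z ≟ y) sym sym (h y))) (sumBy-δ h z u)

  when-∈-supported : {A : Set} {g : A → Maybe Carrier} {xs : List A} →
                     SupportedOn g xs → ∀ x → when (x ∈? xs) (g x) ≡ g x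
  when-∈-supported {xs = xs} g-supp x with x ∈? xs
  ... | yes _  = refl
  ... | no x∉ = sym (g-supp x x∉)

  sumBy-support-invariant : {A : Set} {g : A → Maybe Carrier} {xs ys : List A} →
                            Unique xs → Unique ys → SupportedOn g xs → SupportedOn g ys →
                            sumBy g xs ≡ sumBy g ys
  sumBy-support-invariant {g = g} {xs} {ys} xs-unique ys-unique g-on-xs g-on-ys = begin
    sumBy g xs
      ≡⟨ sumBy-cong xs (λ x _ → trans (sumBy-δ (λ _ → g x) x ys-unique) (when-∈-supported g-on-ys x)) ⟨
    sumBy (λ x → sumBy (λ y → when (x ≟ y) (g x)) ys) xs
      ≡⟨ sumBy-swap _ xs ys ⟩
    sumBy (λ y → sumBy (λ x → when (x ≟ y) (g x)) xs) ys
      ≡⟨ sumBy-cong ys (λ y _ → trans (sumBy-δ˘ g y xs-unique) (when-∈-supported g-on-xs y)) ⟩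
    sumBy g ys ∎
    where open ≡-Reasoning

module EffectAlgebraProperties (E : EffectAlgebra) where
  open EffectAlgebra E

  private
    complement-of-sum : ∀ {a b s} → a ⊕ b ≡ just s → ∃ λ u → (s ′) ⊕ a ≡ just u × b ≡ u ′
    complement-of-sum {a} {b} {s} a⊕b with >>=-just⁻ ((s ′) ⊕ a) {λ u → u ⊕ b} s′⊕a⊕b
      where
        s′⊕a⊕b : ((s ′) ⊕ a >>= λ u → u ⊕ b) ≡ just 𝟙
        s′⊕a⊕b = trans (⊕-assoc (s ′) a b)
                 (trans (cong (_>>= (s ′) ⊕_) a⊕b) (trans (⊕-comm (s ′) s) (′-sum s)))
    ... | u , s′⊕a , u⊕b = u , s′⊕a , ′-unique u b u⊕b

  ⊕-cancelˡ : ∀ {a b c s} → a ⊕ b ≡ just s → a ⊕ c ≡ just s → b ≡ c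
  ⊕-cancelˡ a⊕b a⊕c with complement-of-sum a⊕b | complement-of-sum a⊕c
  ... | u , s′⊕a , b≡u′ | v , s′⊕a′ , c≡v′ =
    trans b≡u′ (trans (cong _′ (just-injective (trans (sym s′⊕a) s′⊕a′))) (sym c≡v′))

module DistributionMonad (M : EffectAlgebra) (G : GradedEffectMonoid M) (em : ExcludedMiddle 0ℓ) where
  private module M = EffectAlgebra M
  open GradedEffectMonoid G
  open Classical em
  open EffectAlgebraProperties M using (⊕-cancelˡ)
  open PCMHomomorphism using (sumBy-hom; when-hom)

  pcmᵉ : M.Carrier → PCM
  pcmᵉ m = EffectAlgebra.pcm (𝔼 m)

  C : M.Carrier → Set
  C m = EffectAlgebra.Carrier (𝔼 m)

  𝟘ᵉ 𝟙ᵉ : ∀ m → C m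
  𝟘ᵉ m = EffectAlgebra.𝟘 (𝔼 m)
  𝟙ᵉ m = EffectAlgebra.𝟙 (𝔼 m)

  module _ {m : M.Carrier} where
    open PCMSums (pcmᵉ m) public
    open Reindexing em (pcmᵉ m) public

  ∇-zeroˡ : ∀ {m n mn} (p : m M.⊕ n ≡ just mn) b → ∇ p (𝟘ᵉ m) b ≡ 𝟘ᵉ mn
  ∇-zeroˡ p = IsBimorphism.zeroˡ (∇-bimorphism p)

  ∇-zeroʳ : ∀ {m n mn} (p : m M.⊕ n ≡ just mn) a → ∇ p a (𝟘ᵉ n) ≡ 𝟘ᵉ mn
  ∇-zeroʳ p = IsBimorphism.zeroʳ (∇-bimorphism p)

  ∇ˡ-hom : ∀ {m n mn} (p : m M.⊕ n ≡ just mn) (b : C n) →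
           IsPCMHomomorphism (pcmᵉ m) (pcmᵉ mn) (λ a → ∇ p a b)
  ∇ˡ-hom p b = record
    { pres-𝟘 = ∇-zeroˡ p b
    ; pres-⊕ = λ a a′ s → IsBimorphism.addˡ (∇-bimorphism p) a a′ s b }

  ∇ʳ-hom : ∀ {m n mn} (p : m M.⊕ n ≡ just mn) (a : C m) →
           IsPCMHomomorphism (pcmᵉ n) (pcmᵉ mn) (∇ p a)
  ∇ʳ-hom p a = record
    { pres-𝟘 = ∇-zeroʳ p a
    ; pres-⊕ = IsBimorphism.addʳ (∇-bimorphism p) a }

  ∇ˡ-supported : ∀ {m n mn X} (p : m M.⊕ n ≡ just mn) {w : X → C m} {b : X → C n} {xs : List X} →
                 SupportedOn (just ∘ w) xs → SupportedOn (λ x → just (∇ p (w x) (b x))) xs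
  ∇ˡ-supported p {b = b} w-supp x x∉ =
    cong just (trans (cong (λ a → ∇ p a (b x)) (just-injective (w-supp x x∉))) (∇-zeroˡ p (b x)))

  ∇ʳ-supported : ∀ {m n mn X} (p : m M.⊕ n ≡ just mn) {a : X → C m} {w : X → C n} {xs : List X} →
                 SupportedOn (just ∘ w) xs → SupportedOn (λ x → just (∇ p (a x) (w x))) xs
  ∇ʳ-supported p {a = a} w-supp x x∉ =
    cong just (trans (cong (∇ p (a x)) (just-injective (w-supp x x∉))) (∇-zeroʳ p (a x)))

  η-true : η true ≡ 𝟙ᵉ M.𝟘
  η-true = trans (IsEffectMorphism.pres-′ η-morphism false)
                 (cong (EffectAlgebra._′ (𝔼 M.𝟘)) (IsEffectMorphism.pres-𝟘 η-morphism))

  ∇-𝟙ˡ : ∀ {m} (p : M.𝟘 M.⊕ m ≡ just m) a → ∇ p (𝟙ᵉ M.𝟘) a ≡ a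
  ∇-𝟙ˡ p a = subst (λ e → ∇ p e a ≡ a) η-true (∇-unitˡ p a)

  ∇-𝟙ʳ : ∀ {m} (p : m M.⊕ M.𝟘 ≡ just m) a → ∇ p a (𝟙ᵉ M.𝟘) ≡ a
  ∇-𝟙ʳ p a = subst (λ e → ∇ p a e ≡ a) η-true (∇-unitʳ p a)

  ∇-𝟙ʳ-cong : ∀ {m k k′ o} (q : m M.⊕ k ≡ just o) (q′ : m M.⊕ k′ ≡ just o) → k ≡ k′ →
              ∀ a → ∇ q a (𝟙ᵉ k) ≡ ∇ q′ a (𝟙ᵉ k′)
  ∇-𝟙ʳ-cong q q′ refl a = cong (λ e → ∇ e a (𝟙ᵉ _)) (Decidable⇒UIP.≡-irrelevant _≟_ q q′)

  mass : ∀ {m X} → D (𝔼 m) X → C m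
  mass d = proj₁ (D.sum-defined d)

  sumBy-Δ : ∀ {m X} (d : D (𝔼 m) X) → sumBy (just ∘ D.Δ d) (D.supp d) ≡ just (mass d)
  sumBy-Δ d = trans (sym (sumL-map (D.Δ d) (D.supp d))) (proj₂ (D.sum-defined d))

  Δ-supported : ∀ {m X} (d : D (𝔼 m) X) → SupportedOn (just ∘ D.Δ d) (D.supp d)
  Δ-supported d x x∉ = cong just (D.supp-covers d x x∉)

  ≈D-supported : ∀ {m X} (d d′ : D (𝔼 m) X) → _≈D_ (𝔼 m) d d′ →
                 SupportedOn (just ∘ D.Δ d′) (D.supp d)
  ≈D-supported d d′ d≈d′ x x∉ = trans (cong just (sym (d≈d′ x))) (Δ-supported d x x∉)

  Δ-by-δ : ∀ {m X} (d : D (𝔼 m) X) y →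
           sumBy (λ x → when (x ≟ y) (just (D.Δ d x))) (D.supp d) ≡ just (D.Δ d y)
  Δ-by-δ d y = trans (sumBy-δ˘ (just ∘ D.Δ d) y (D.supp-unique d)) (when-∈-supported (Δ-supported d) y)

  module _ {m X} (g : X → Maybe (C m)) (xs : List X) (xs-unique : Unique xs)
           (g-supported : SupportedOn g xs) (g-summable : Defined (sumBy g xs)) where
    private
      g-defined : ∀ x → Defined (g x)
      g-defined x with x ∈? xs
      ... | yes x∈ = summand-defined g x∈ g-summable
      ... | no x∉  = 𝟘ᵉ m , g-supported x x∉

    fromWeights : D (𝔼 m) X
    fromWeights = record
      { Δ           = proj₁ ∘ g-defined
      ; supp        = xs
      ; supp-unique = xs-unique
      ; supp-covers = λ x x∉ → just-injective (trans (sym (proj₂ (g-defined x))) (g-supported x x∉))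
      ; sum-defined = proj₁ g-summable ,
          trans (sumL-map _ xs) (trans (sumBy-cong xs (λ x _ → sym (proj₂ (g-defined x)))) (proj₂ g-summable)) }

    fromWeights-Δ : ∀ x → just (D.Δ fromWeights x) ≡ g x
    fromWeights-Δ x = sym (proj₂ (g-defined x))

  image-weight : ∀ {m X Y} → (X → Y) → D (𝔼 m) X → Y → Maybe (C m)
  image-weight f d y = sumBy (λ x → when (f x ≟ y) (just (D.Δ d x))) (D.supp d)

  image-supp : ∀ {m X Y} → (X → Y) → D (𝔼 m) X → List Y
  image-supp f d = deduplicate _≟_ (map f (D.supp d))

  image-supp-unique : ∀ {m X Y} (f : X → Y) (d : D (𝔼 m) X) → Unique (image-supp f d)
  image-supp-unique f d = deduplicate-! _≟_ (map f (D.supp d))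

  ∈-image-supp : ∀ {m X Y} (f : X → Y) (d : D (𝔼 m) X) {x} → x ∈ D.supp d → f x ∈ image-supp f d
  ∈-image-supp f d x∈ = ∈-deduplicate⁺ _≟_ (∈-map⁺ f x∈)

  sumBy-image : ∀ {m k X Y} (f : X → Y) (d : D (𝔼 m) X) (H : X → Y → Maybe (C k)) →
                sumBy (λ y → sumBy (λ x → when (f x ≟ y) (H x y)) (D.supp d)) (image-supp f d)
                ≡ sumBy (λ x → H x (f x)) (D.supp d)
  sumBy-image f d H =
    trans (sym (sumBy-swap (λ x y → when (f x ≟ y) (H x y)) (D.supp d) (image-supp f d)))
          (sumBy-cong (D.supp d) (λ x x∈ →
             sumBy-δ-∈ (H x) (f x) (image-supp-unique f d) (∈-image-supp f d x∈)))

  image-weight-supported : ∀ {m X Y} (f : X → Y) (d : D (𝔼 m) X) →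
                           SupportedOn (image-weight f d) (image-supp f d)
  image-weight-supported f d y y∉ = sumBy-zero (D.supp d) (λ x x∈ →
    when-no (f x ≟ y) (λ fx≡y → y∉ (subst (_∈ image-supp f d) fx≡y (∈-image-supp f d x∈))) _)

  image-weight-summable : ∀ {m X Y} (f : X → Y) (d : D (𝔼 m) X) →
                          sumBy (image-weight f d) (image-supp f d) ≡ just (mass d)
  image-weight-summable f d = trans (sumBy-image f d (λ x _ → just (D.Δ d x))) (sumBy-Δ d)

  fmapD : ∀ {m X Y} → (X → Y) → D (𝔼 m) X → D (𝔼 m) Y
  fmapD f d = fromWeights (image-weight f d) (image-supp f d) (image-supp-unique f d)
                (image-weight-supported f d) (mass d , image-weight-summable f d)

  fmapD-Δ : ∀ {m X Y} (f : X → Y) (d : D (𝔼 m) X) y → just (D.Δ (fmapD f d) y) ≡ image-weight f d y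
  fmapD-Δ f d = fromWeights-Δ (image-weight f d) (image-supp f d) (image-supp-unique f d)
                  (image-weight-supported f d) (mass d , image-weight-summable f d)

  unit-weight : ∀ {X} → X → X → Maybe (C M.𝟘)
  unit-weight x y = when (x ≟ y) (just (𝟙ᵉ M.𝟘))

  private
    singleton-unique : ∀ {X : Set} (x : X) → Unique (x ∷ [])
    singleton-unique x = All.[] ∷ []

    unit-weight-supported : ∀ {X} (x : X) → SupportedOn (unit-weight x) (x ∷ [])
    unit-weight-supported x y y∉ = when-no (x ≟ y) (λ x≡y → y∉ (here (sym x≡y))) _

    unit-weight-summable : ∀ {X} (x : X) → sumBy (unit-weight x) (x ∷ []) ≡ just (𝟙ᵉ M.𝟘)
    unit-weight-summable x = sumBy-δ-∈ _ x (singleton-unique x) (here refl)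

  unitD : ∀ {X} → X → D (𝔼 M.𝟘) X
  unitD x = fromWeights (unit-weight x) (x ∷ []) (singleton-unique x)
              (unit-weight-supported x) (𝟙ᵉ M.𝟘 , unit-weight-summable x)

  unitD-Δ : ∀ {X} (x y : X) → just (D.Δ (unitD x) y) ≡ unit-weight x y
  unitD-Δ x = fromWeights-Δ (unit-weight x) (x ∷ []) (singleton-unique x)
                (unit-weight-supported x) (𝟙ᵉ M.𝟘 , unit-weight-summable x)

  unitD-at : ∀ {X} (x : X) → D.Δ (unitD x) x ≡ 𝟙ᵉ M.𝟘
  unitD-at x = just-injective (trans (unitD-Δ x x) (when-yes (x ≟ x) refl _))

  unitD-off : ∀ {X} (x y : X) → ¬ (x ≡ y) → D.Δ (unitD x) y ≡ 𝟘ᵉ M.𝟘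
  unitD-off x y x≢y = just-injective (trans (unitD-Δ x y) (when-no (x ≟ y) x≢y _))

  extD : ∀ {m n X} → m M.≼ n → D (𝔼 m) X → D (𝔼 n) X
  extD p d = record
    { Δ           = λ x → ∇ (proj₂ p) (D.Δ d x) (𝟙ᵉ (proj₁ p))
    ; supp        = D.supp d
    ; supp-unique = D.supp-unique d
    ; supp-covers = λ x x∉ → just-injective (∇ˡ-supported (proj₂ p) (Δ-supported d) x x∉)
    ; sum-defined = _ , trans (sumL-map _ (D.supp d))
        (sumBy-hom (∇ˡ-hom (proj₂ p) (𝟙ᵉ (proj₁ p))) (just ∘ D.Δ d) (D.supp d) (sumBy-Δ d)) }

  mult-weight : ∀ {m n mn X} → m M.⊕ n ≡ just mn → D (𝔼 m) (D (𝔼 n) X) → X → Maybe (C mn)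
  mult-weight p Φ x = sumBy (λ Ψ → just (∇ p (D.Δ Φ Ψ) (D.Δ Ψ x))) (D.supp Φ)

  mult-supp : ∀ {m n X} → D (𝔼 m) (D (𝔼 n) X) → List X
  mult-supp Φ = deduplicate _≟_ (concatMap D.supp (D.supp Φ))

  mult-supp-unique : ∀ {m n X} (Φ : D (𝔼 m) (D (𝔼 n) X)) → Unique (mult-supp Φ)
  mult-supp-unique Φ = deduplicate-! _≟_ (concatMap D.supp (D.supp Φ))

  Δ-supported-on-mult-supp : ∀ {m n X} (Φ : D (𝔼 m) (D (𝔼 n) X)) {Ψ} → Ψ ∈ D.supp Φ →
                             SupportedOn (just ∘ D.Δ Ψ) (mult-supp Φ)
  Δ-supported-on-mult-supp Φ {Ψ} Ψ∈ x x∉ = Δ-supported Ψ x λ x∈ →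
    x∉ (∈-deduplicate⁺ _≟_ (∈-concatMap⁺ D.supp (lose {P = λ Ψ′ → x ∈ D.supp Ψ′} Ψ∈ x∈)))

  mult-weight-supported : ∀ {m n mn X} (p : m M.⊕ n ≡ just mn) (Φ : D (𝔼 m) (D (𝔼 n) X)) →
                          SupportedOn (mult-weight p Φ) (mult-supp Φ)
  mult-weight-supported p Φ x x∉ = sumBy-zero (D.supp Φ) (λ Ψ Ψ∈ →
    ∇ʳ-supported p (Δ-supported-on-mult-supp Φ Ψ∈) x x∉)

  mult-weight-summable : ∀ {m n mn X} (p : m M.⊕ n ≡ just mn) (Φ : D (𝔼 m) (D (𝔼 n) X)) →
                         Defined (sumBy (mult-weight p Φ) (mult-supp Φ))
  mult-weight-summable {n = n} {mn} {X} p Φ =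
    subst Defined (sym regroup) g-summable
    where
      g g′ : D (𝔼 n) X → Maybe (C mn)
      g  Ψ = just (∇ p (D.Δ Φ Ψ) (mass Ψ))
      g′ Ψ = just (∇ p (D.Δ Φ Ψ) (EffectAlgebra._′ (𝔼 n) (mass Ψ)))

      mass-on-mult-supp : ∀ {Ψ} → Ψ ∈ D.supp Φ → sumBy (just ∘ D.Δ Ψ) (mult-supp Φ) ≡ just (mass Ψ)
      mass-on-mult-supp {Ψ} Ψ∈ = trans
        (sumBy-support-invariant (mult-supp-unique Φ) (D.supp-unique Ψ)
           (Δ-supported-on-mult-supp Φ Ψ∈) (Δ-supported Ψ))
        (sumBy-Δ Ψ)

      regroup : sumBy (mult-weight p Φ) (mult-supp Φ) ≡ sumBy g (D.supp Φ)
      regroup = trans (sumBy-swap _ (mult-supp Φ) (D.supp Φ)) (sumBy-cong (D.supp Φ) λ Ψ Ψ∈ →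
        sumBy-hom (∇ʳ-hom p (D.Δ Φ Ψ)) (just ∘ D.Δ Ψ) (mult-supp Φ) (mass-on-mult-supp Ψ∈))

      bound : sumBy (λ Ψ → g Ψ ⊕? g′ Ψ) (D.supp Φ) ≡ just (∇ p (mass Φ) (𝟙ᵉ n))
      bound = trans
        (sumBy-cong (D.supp Φ) (λ Ψ _ →
           IsBimorphism.addʳ (∇-bimorphism p) (D.Δ Φ Ψ) _ _ _ (EffectAlgebra.′-sum (𝔼 n) (mass Ψ))))
        (sumBy-hom (∇ˡ-hom p (𝟙ᵉ n)) (just ∘ D.Δ Φ) (D.supp Φ) (sumBy-Δ Φ))

      g-summable : Defined (sumBy g (D.supp Φ))
      g-summable = ⊕?-definedˡ (sumBy g (D.supp Φ)) (sumBy g′ (D.supp Φ))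
                     (_ , trans (sym (sumBy-⊕? g g′ (D.supp Φ))) bound)

  multD : ∀ {m n mn X} → m M.⊕ n ≡ just mn → D (𝔼 m) (D (𝔼 n) X) → D (𝔼 mn) X
  multD p Φ = fromWeights (mult-weight p Φ) (mult-supp Φ) (mult-supp-unique Φ)
                (mult-weight-supported p Φ) (mult-weight-summable p Φ)

  multD-Δ : ∀ {m n mn X} (p : m M.⊕ n ≡ just mn) (Φ : D (𝔼 m) (D (𝔼 n) X)) x →
            just (D.Δ (multD p Φ) x) ≡ mult-weight p Φ x
  multD-Δ p Φ = fromWeights-Δ (mult-weight p Φ) (mult-supp Φ) (mult-supp-unique Φ)
                  (mult-weight-supported p Φ) (mult-weight-summable p Φ)

  sumBy⇒PreSum : ∀ {m X Y} (Δ : X → C m) (f : X → Y) (y : Y) (xs : List X) {s} →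
           sumBy (λ x → when (f x ≟ y) (just (Δ x))) xs ≡ just s → PreSum (𝔼 m) Δ f y xs s
  sumBy⇒PreSum Δ f y []       refl = []
  sumBy⇒PreSum Δ f y (x ∷ xs) Σ≡s with f x ≟ y
  ... | yes fx≡y with ⊕?-just⁻ (just (Δ x)) _ Σ≡s
  ...   | _ , _ , refl , rest≡ , Δx⊕rest = hit fx≡y (sumBy⇒PreSum Δ f y xs rest≡) Δx⊕rest
  sumBy⇒PreSum Δ f y (x ∷ xs) Σ≡s | no fx≢y =
    miss fx≢y (sumBy⇒PreSum Δ f y xs (trans (sym (⊕?-identityˡ _)) Σ≡s))

  operations : DOperations M G
  operations = record
    { fmap          = fmapD
    ; unit          = unitD
    ; mult          = multD
    ; ext           = extD
    ; fmap-spec     = λ f d y → sumBy⇒PreSum (D.Δ d) f y (D.supp d) (sym (fmapD-Δ f d y))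
    ; unit-spec-at  = unitD-at
    ; unit-spec-off = unitD-off
    ; mult-spec     = λ p Φ x → trans (sumL-map _ (D.supp Φ)) (sym (multD-Δ p Φ x))
    ; ext-spec      = λ p d x → refl }

  image-hom : ∀ {m k X Y} {h : C m → C k} → IsPCMHomomorphism (pcmᵉ m) (pcmᵉ k) h →
              (f : X → Y) (t : D (𝔼 m) X) (y : Y) →
              just (h (D.Δ (fmapD f t) y)) ≡ sumBy (λ x → when (f x ≟ y) (just (h (D.Δ t x)))) (D.supp t)
  image-hom h-hom f t y = sym (trans
    (sumBy-cong (D.supp t) (λ x _ → sym (when-hom h-hom (f x ≟ y) (just (D.Δ t x)))))
    (sumBy-hom h-hom _ (D.supp t) (sym (fmapD-Δ f t y))))

  mult-hom : ∀ {m n mn k X} {h : C mn → C k} → IsPCMHomomorphism (pcmᵉ mn) (pcmᵉ k) h →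
             (p : m M.⊕ n ≡ just mn) (Φ : D (𝔼 m) (D (𝔼 n) X)) (x : X) →
             just (h (D.Δ (multD p Φ) x)) ≡ sumBy (λ Ψ → just (h (∇ p (D.Δ Φ Ψ) (D.Δ Ψ x)))) (D.supp Φ)
  mult-hom h-hom p Φ x = sym (sumBy-hom h-hom _ (D.supp Φ) (sym (multD-Δ p Φ x)))

  sumBy-∇-image : ∀ {m n mn X Y} (p : m M.⊕ n ≡ just mn) (f : X → Y) (t : D (𝔼 m) X) (b : Y → C n) →
                  sumBy (λ y → just (∇ p (D.Δ (fmapD f t) y) (b y))) (image-supp f t)
                  ≡ sumBy (λ x → just (∇ p (D.Δ t x) (b (f x)))) (D.supp t)
  sumBy-∇-image p f t b = trans
    (sumBy-cong (image-supp f t) (λ y _ → image-hom (∇ˡ-hom p (b y)) f t y))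
    (sumBy-image f t (λ x y → just (∇ p (D.Δ t x) (b y))))

  ∇-unitD : ∀ {m X} (p : m M.⊕ M.𝟘 ≡ just m) (a : C m) (x y : X) →
            just (∇ p a (D.Δ (unitD x) y)) ≡ when (x ≟ y) (just a)
  ∇-unitD p a x y = begin
    Maybe.map (∇ p a) (just (D.Δ (unitD x) y))  ≡⟨ cong (Maybe.map (∇ p a)) (unitD-Δ x y) ⟩
    Maybe.map (∇ p a) (unit-weight x y)         ≡⟨ when-hom (∇ʳ-hom p a) (x ≟ y) _ ⟩
    when (x ≟ y) (just (∇ p a (𝟙ᵉ M.𝟘)))        ≡⟨ cong (when (x ≟ y) ∘ just) (∇-𝟙ʳ p a) ⟩
    when (x ≟ y) (just a)                       ∎
    where open ≡-Reasoning

  fmap-cong : ∀ {m X Y} (f : X → Y) {t t′ : D (𝔼 m) X} → _≈D_ (𝔼 m) t t′ →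
              _≈D_ (𝔼 m) (fmapD f t) (fmapD f t′)
  fmap-cong f {t} {t′} t≈t′ y = just-injective (begin
    just (D.Δ (fmapD f t) y)
      ≡⟨ fmapD-Δ f t y ⟩
    image-weight f t y
      ≡⟨ sumBy-cong (D.supp t) (λ x _ → cong (when (f x ≟ y) ∘ just) (t≈t′ x)) ⟩
    sumBy (λ x → when (f x ≟ y) (just (D.Δ t′ x))) (D.supp t)
      ≡⟨ sumBy-support-invariant (D.supp-unique t) (D.supp-unique t′)
           (when-supported (λ x → f x ≟ y) (≈D-supported t t′ t≈t′))
           (when-supported (λ x → f x ≟ y) (Δ-supported t′)) ⟩
    image-weight f t′ y
      ≡⟨ fmapD-Δ f t′ y ⟨
    just (D.Δ (fmapD f t′) y) ∎)
    where open ≡-Reasoning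

  fmap-ext : ∀ {m X Y} (f g : X → Y) → (∀ x → f x ≡ g x) → (t : D (𝔼 m) X) →
             _≈D_ (𝔼 m) (fmapD f t) (fmapD g t)
  fmap-ext f g f≗g t y = just-injective (begin
    just (D.Δ (fmapD f t) y)
      ≡⟨ fmapD-Δ f t y ⟩
    image-weight f t y
      ≡⟨ sumBy-cong (D.supp t) (λ x _ →
           when-⇔ (f x ≟ y) (g x ≟ y) (trans (sym (f≗g x))) (trans (f≗g x)) (just (D.Δ t x))) ⟩
    image-weight g t y
      ≡⟨ fmapD-Δ g t y ⟨
    just (D.Δ (fmapD g t) y) ∎)
    where open ≡-Reasoning

  fmap-id : ∀ {m X} (t : D (𝔼 m) X) → _≈D_ (𝔼 m) (fmapD id t) t
  fmap-id t y = just-injective (trans (fmapD-Δ id t y) (Δ-by-δ t y))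

  fmap-∘ : ∀ {m X Y Z} (f : Y → Z) (g : X → Y) (t : D (𝔼 m) X) →
           _≈D_ (𝔼 m) (fmapD (f ∘ g) t) (fmapD f (fmapD g t))
  fmap-∘ f g t z = just-injective (begin
    just (D.Δ (fmapD (f ∘ g) t) z)
      ≡⟨ fmapD-Δ (f ∘ g) t z ⟩
    sumBy (λ x → when (f (g x) ≟ z) (just (D.Δ t x))) (D.supp t)
      ≡⟨ sumBy-image g t (λ x y → when (f y ≟ z) (just (D.Δ t x))) ⟨
    sumBy (λ y → sumBy (λ x → when (g x ≟ y) (when (f y ≟ z) (just (D.Δ t x)))) (D.supp t)) (image-supp g t)
      ≡⟨ sumBy-cong (image-supp g t) (λ y _ → sumBy-cong (D.supp t) (λ x _ →
           when-comm (g x ≟ y) (f y ≟ z) (just (D.Δ t x)))) ⟩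
    sumBy (λ y → sumBy (λ x → when (f y ≟ z) (when (g x ≟ y) (just (D.Δ t x)))) (D.supp t)) (image-supp g t)
      ≡⟨ sumBy-cong (image-supp g t) (λ y _ → when-sumBy (f y ≟ z) _ (D.supp t)) ⟨
    sumBy (λ y → when (f y ≟ z) (image-weight g t y)) (image-supp g t)
      ≡⟨ sumBy-cong (image-supp g t) (λ y _ → cong (when (f y ≟ z)) (fmapD-Δ g t y)) ⟨
    image-weight f (fmapD g t) z
      ≡⟨ fmapD-Δ f (fmapD g t) z ⟨
    just (D.Δ (fmapD f (fmapD g t)) z) ∎)
    where open ≡-Reasoning

  η-natural : ∀ {X Y} (f : X → Y) (x : X) → _≈D_ (𝔼 M.𝟘) (fmapD f (unitD x)) (unitD (f x))
  η-natural f x y = just-injective (begin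
    just (D.Δ (fmapD f (unitD x)) y)
      ≡⟨ fmapD-Δ f (unitD x) y ⟩
    when (f x ≟ y) (just (D.Δ (unitD x) x)) ⊕? just (𝟘ᵉ M.𝟘)
      ≡⟨ ⊕?-identityʳ _ ⟩
    when (f x ≟ y) (just (D.Δ (unitD x) x))
      ≡⟨ cong (when (f x ≟ y) ∘ just) (unitD-at x) ⟩
    unit-weight (f x) y
      ≡⟨ unitD-Δ (f x) y ⟨
    just (D.Δ (unitD (f x)) y) ∎)
    where open ≡-Reasoning

  μ-cong : ∀ {m n mn X} (p : m M.⊕ n ≡ just mn) {t t′ : D (𝔼 m) (D (𝔼 n) X)} →
           _≈D_ (𝔼 m) t t′ → _≈D_ (𝔼 mn) (multD p t) (multD p t′)
  μ-cong p {t} {t′} t≈t′ x = just-injective (begin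
    just (D.Δ (multD p t) x)
      ≡⟨ multD-Δ p t x ⟩
    mult-weight p t x
      ≡⟨ sumBy-cong (D.supp t) (λ Ψ _ → cong (λ a → just (∇ p a (D.Δ Ψ x))) (t≈t′ Ψ)) ⟩
    sumBy (λ Ψ → just (∇ p (D.Δ t′ Ψ) (D.Δ Ψ x))) (D.supp t)
      ≡⟨ sumBy-support-invariant (D.supp-unique t) (D.supp-unique t′)
           (∇ˡ-supported p (≈D-supported t t′ t≈t′)) (∇ˡ-supported p (Δ-supported t′)) ⟩
    mult-weight p t′ x
      ≡⟨ multD-Δ p t′ x ⟨
    just (D.Δ (multD p t′) x) ∎)
    where open ≡-Reasoning

  μ-natural : ∀ {m n mn X Y} (p : m M.⊕ n ≡ just mn) (f : X → Y) (Φ : D (𝔼 m) (D (𝔼 n) X)) →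
              _≈D_ (𝔼 mn) (fmapD f (multD p Φ)) (multD p (fmapD (fmapD f) Φ))
  μ-natural {n = n} {mn} {X} p f Φ y = just-injective (begin
    just (D.Δ (fmapD f (multD p Φ)) y)
      ≡⟨ fmapD-Δ f (multD p Φ) y ⟩
    sumBy (λ x → when (f x ≟ y) (just (D.Δ (multD p Φ) x))) (mult-supp Φ)
      ≡⟨ sumBy-cong (mult-supp Φ) (λ x _ →
           trans (cong (when (f x ≟ y)) (multD-Δ p Φ x)) (when-sumBy (f x ≟ y) _ (D.supp Φ))) ⟩
    sumBy (λ x → sumBy (λ Ψ → F Ψ x) (D.supp Φ)) (mult-supp Φ)
      ≡⟨ sumBy-swap (λ x Ψ → F Ψ x) (mult-supp Φ) (D.supp Φ) ⟩
    sumBy (λ Ψ → sumBy (F Ψ) (mult-supp Φ)) (D.supp Φ)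
      ≡⟨ sumBy-cong (D.supp Φ) (λ Ψ Ψ∈ → sumBy-support-invariant (mult-supp-unique Φ) (D.supp-unique Ψ)
           (when-supported (λ x → f x ≟ y) (∇ʳ-supported p (Δ-supported-on-mult-supp Φ Ψ∈)))
           (when-supported (λ x → f x ≟ y) (∇ʳ-supported p (Δ-supported Ψ)))) ⟩
    sumBy (λ Ψ → sumBy (F Ψ) (D.supp Ψ)) (D.supp Φ)
      ≡⟨ sumBy-cong (D.supp Φ) (λ Ψ _ → image-hom (∇ʳ-hom p (D.Δ Φ Ψ)) f Ψ y) ⟨
    sumBy (λ Ψ → just (∇ p (D.Δ Φ Ψ) (D.Δ (fmapD f Ψ) y))) (D.supp Φ)
      ≡⟨ sumBy-∇-image p (fmapD f) Φ (λ Ψ′ → D.Δ Ψ′ y) ⟨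
    mult-weight p (fmapD (fmapD f) Φ) y
      ≡⟨ multD-Δ p (fmapD (fmapD f) Φ) y ⟨
    just (D.Δ (multD p (fmapD (fmapD f) Φ)) y) ∎)
    where
      open ≡-Reasoning
      F : D (𝔼 n) X → X → Maybe (C mn)
      F Ψ x = when (f x ≟ y) (just (∇ p (D.Δ Φ Ψ) (D.Δ Ψ x)))

  μ-assoc : ∀ {m n o mn no mno X}
            (p : m M.⊕ n ≡ just mn) (q : mn M.⊕ o ≡ just mno)
            (r : n M.⊕ o ≡ just no) (s : m M.⊕ no ≡ just mno)
            (t : D (𝔼 m) (D (𝔼 n) (D (𝔼 o) X))) →
            _≈D_ (𝔼 mno) (multD s (fmapD (multD r) t)) (multD q (multD p t))
  μ-assoc p q r s t x = just-injective (begin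
    just (D.Δ (multD s (fmapD (multD r) t)) x)
      ≡⟨ multD-Δ s (fmapD (multD r) t) x ⟩
    mult-weight s (fmapD (multD r) t) x
      ≡⟨ sumBy-∇-image s (multD r) t (λ Ψ → D.Δ Ψ x) ⟩
    sumBy (λ T → just (∇ s (D.Δ t T) (D.Δ (multD r T) x))) (D.supp t)
      ≡⟨ sumBy-cong (D.supp t) (λ T _ → mult-hom (∇ʳ-hom s (D.Δ t T)) r T x) ⟩
    sumBy (λ T → sumBy (λ Ψ → just (∇ s (D.Δ t T) (∇ r (D.Δ T Ψ) (D.Δ Ψ x)))) (D.supp T)) (D.supp t)
      ≡⟨ sumBy-cong (D.supp t) (λ T T∈ → sumBy-support-invariant (D.supp-unique T) (mult-supp-unique t)
           (∇ʳ-supported s (∇ˡ-supported r (Δ-supported T)))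
           (∇ʳ-supported s (∇ˡ-supported r (Δ-supported-on-mult-supp t T∈)))) ⟩
    sumBy (λ T → sumBy (λ Ψ → just (∇ s (D.Δ t T) (∇ r (D.Δ T Ψ) (D.Δ Ψ x)))) (mult-supp t)) (D.supp t)
      ≡⟨ sumBy-cong (D.supp t) (λ T _ → sumBy-cong (mult-supp t) (λ Ψ _ →
           cong just (∇-assoc p q r s (D.Δ t T) (D.Δ T Ψ) (D.Δ Ψ x)))) ⟨
    sumBy (λ T → sumBy (λ Ψ → just (∇ q (∇ p (D.Δ t T) (D.Δ T Ψ)) (D.Δ Ψ x))) (mult-supp t)) (D.supp t)
      ≡⟨ sumBy-swap _ (mult-supp t) (D.supp t) ⟨
    sumBy (λ Ψ → sumBy (λ T → just (∇ q (∇ p (D.Δ t T) (D.Δ T Ψ)) (D.Δ Ψ x))) (D.supp t)) (mult-supp t)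
      ≡⟨ sumBy-cong (mult-supp t) (λ Ψ _ → mult-hom (∇ˡ-hom q (D.Δ Ψ x)) p t Ψ) ⟨
    mult-weight q (multD p t) x
      ≡⟨ multD-Δ q (multD p t) x ⟨
    just (D.Δ (multD q (multD p t)) x) ∎)
    where open ≡-Reasoning

  μ-unitʳ : ∀ {m X} (p : m M.⊕ M.𝟘 ≡ just m) (t : D (𝔼 m) X) →
            _≈D_ (𝔼 m) (multD p (fmapD unitD t)) t
  μ-unitʳ p t x = just-injective (begin
    just (D.Δ (multD p (fmapD unitD t)) x)
      ≡⟨ multD-Δ p (fmapD unitD t) x ⟩
    mult-weight p (fmapD unitD t) x
      ≡⟨ sumBy-∇-image p unitD t (λ Ψ → D.Δ Ψ x) ⟩
    sumBy (λ x′ → just (∇ p (D.Δ t x′) (D.Δ (unitD x′) x))) (D.supp t)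
      ≡⟨ sumBy-cong (D.supp t) (λ x′ _ → ∇-unitD p (D.Δ t x′) x′ x) ⟩
    sumBy (λ x′ → when (x′ ≟ x) (just (D.Δ t x′))) (D.supp t)
      ≡⟨ Δ-by-δ t x ⟩
    just (D.Δ t x) ∎)
    where open ≡-Reasoning

  μ-unitˡ : ∀ {m X} (p : M.𝟘 M.⊕ m ≡ just m) (t : D (𝔼 m) X) →
            _≈D_ (𝔼 m) (multD p (unitD t)) t
  μ-unitˡ p t x = just-injective (begin
    just (D.Δ (multD p (unitD t)) x)
      ≡⟨ multD-Δ p (unitD t) x ⟩
    just (∇ p (D.Δ (unitD t) t) (D.Δ t x)) ⊕? just (𝟘ᵉ _)
      ≡⟨ ⊕?-identityʳ _ ⟩
    just (∇ p (D.Δ (unitD t) t) (D.Δ t x))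
      ≡⟨ cong just (trans (cong (λ a → ∇ p a (D.Δ t x)) (unitD-at t)) (∇-𝟙ˡ p (D.Δ t x))) ⟩
    just (D.Δ t x) ∎)
    where open ≡-Reasoning

  ξ-cong : ∀ {m n X} (p : m M.≼ n) {t t′ : D (𝔼 m) X} → _≈D_ (𝔼 m) t t′ →
           _≈D_ (𝔼 n) (extD p t) (extD p t′)
  ξ-cong p t≈t′ x = cong (λ a → ∇ (proj₂ p) a (𝟙ᵉ (proj₁ p))) (t≈t′ x)

  ξ-natural : ∀ {m n X Y} (p : m M.≼ n) (f : X → Y) (t : D (𝔼 m) X) →
              _≈D_ (𝔼 n) (fmapD f (extD p t)) (extD p (fmapD f t))
  ξ-natural p f t y = just-injective
    (trans (fmapD-Δ f (extD p t) y) (sym (image-hom (∇ˡ-hom (proj₂ p) (𝟙ᵉ (proj₁ p))) f t y)))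

  ξ-refl : ∀ {m X} (p : m M.≼ m) (t : D (𝔼 m) X) → _≈D_ (𝔼 m) (extD p t) t
  ξ-refl {m} (k , q) t x =
    trans (∇-𝟙ʳ-cong q m⊕𝟘 (⊕-cancelˡ q m⊕𝟘) (D.Δ t x)) (∇-𝟙ʳ m⊕𝟘 (D.Δ t x))
    where
      m⊕𝟘 : m M.⊕ M.𝟘 ≡ just m
      m⊕𝟘 = PCMSums.⊕-identityʳ M.pcm m

  ξ-trans : ∀ {m n o X} (p : m M.≼ n) (q : n M.≼ o) (r : m M.≼ o) (t : D (𝔼 m) X) →
            _≈D_ (𝔼 o) (extD q (extD p t)) (extD r t)
  ξ-trans {m} {o = o} (k₁ , q₁) (k₂ , q₂) (k₃ , q₃) t x with >>=-just⁻ (k₁ M.⊕ k₂) m⊕k₁⊕k₂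
    where
      m⊕k₁⊕k₂ : (k₁ M.⊕ k₂ >>= m M.⊕_) ≡ just o
      m⊕k₁⊕k₂ = trans (sym (M.⊕-assoc m k₁ k₂)) (trans (cong (_>>= M._⊕ k₂) q₁) q₂)
  ... | k₁₂ , k₁⊕k₂ , m⊕k₁₂ = begin
    ∇ q₂ (∇ q₁ (D.Δ t x) (𝟙ᵉ k₁)) (𝟙ᵉ k₂)
      ≡⟨ ∇-assoc q₁ q₂ k₁⊕k₂ m⊕k₁₂ (D.Δ t x) (𝟙ᵉ k₁) (𝟙ᵉ k₂) ⟩
    ∇ m⊕k₁₂ (D.Δ t x) (∇ k₁⊕k₂ (𝟙ᵉ k₁) (𝟙ᵉ k₂))
      ≡⟨ cong (∇ m⊕k₁₂ (D.Δ t x)) (IsBimorphism.one (∇-bimorphism k₁⊕k₂)) ⟩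
    ∇ m⊕k₁₂ (D.Δ t x) (𝟙ᵉ k₁₂)
      ≡⟨ ∇-𝟙ʳ-cong m⊕k₁₂ q₃ (⊕-cancelˡ m⊕k₁₂ q₃) (D.Δ t x) ⟩
    ∇ q₃ (D.Δ t x) (𝟙ᵉ k₃) ∎
    where open ≡-Reasoning

  isExtensibleGradedMonad : IsExtensibleGradedMonadD M G operations
  isExtensibleGradedMonad = record
    { isGradedMonad = record
      { ≈-equiv   = record
        { refl  = λ _ → refl
        ; sym   = λ d≈d′ x → sym (d≈d′ x)
        ; trans = λ d≈d′ d′≈d″ x → trans (d≈d′ x) (d′≈d″ x) }
      ; fmap-cong = fmap-cong
      ; fmap-ext  = fmap-ext
      ; fmap-id   = fmap-id
      ; fmap-∘    = fmap-∘
      ; η-natural = η-natural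
      ; μ-cong    = μ-cong
      ; μ-natural = μ-natural
      ; μ-assoc   = μ-assoc
      ; μ-unitʳ   = μ-unitʳ
      ; μ-unitˡ   = μ-unitˡ }
    ; ξ-cong    = ξ-cong
    ; ξ-natural = ξ-natural
    ; ξ-refl    = ξ-refl
    ; ξ-trans   = ξ-trans }

mainTheorem8 : (M : EffectAlgebra) (G : GradedEffectMonoid M) →
    ExcludedMiddle 0ℓ →
    Σ (DOperations M G) (IsExtensibleGradedMonadD M G)
mainTheorem8 M G em = operations , isExtensibleGradedMonad
  where open DistributionMonad M G em
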